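{- Let $G$ be a simple graph without isolated vertices, with $m(G)$ edges and arranged degree sequence $d_1\ge d_2\ge\cdots\ge d_n$. Let $$k^*=\min\Big\{k\in\mathbb{N},\ 2k\le n\ :\ \sum_{i=1}^{2k}d_i-m(G)-k\ge 0\Big\}.$$ Then every maximal matching $M$ of $G$ satisfies $|M|\ge k^*$. Consequently, every realization of this degree sequence contains a matching of size $k^*$ (the degree sequence is forcibly $k^*$-matching graphic).
   Context: A matching is a set of pairwise disjoint edges; it is maximal if it is not a proper subset of another matching. A realization of a degree sequence is a simple graph (with vertex labelling) having that degree sequence. -}

module Defs where

open import Data.Bool using (Bool; true; false; if_then_else_; _∧_)
open import Data.Nat using (ℕ; zero; suc; _+_; _*_; _≤_; _<_)
open import Data.Nat.Properties using (_<?_)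
open import Data.Fin using (Fin; toℕ)
open import Data.List using (List; map; allFin; length)
open import Data.Nat.ListAction using (sum)
open import Data.List.Relation.Unary.All using (All)
open import Data.List.Relation.Unary.AllPairs using (AllPairs)
open import Data.List.Relation.Binary.Subset.Propositional using (_⊆_)
open import Data.Product using (_×_; _,_; Σ; ∃)
open import Relation.Binary.PropositionalEquality using (_≡_; _≢_)
open import Relation.Nullary using (¬_; does)

Graph : ℕ → Set
Graph n = Fin n → Fin n → Bool

IsSimple : ∀ {n} → Graph n → Set
IsSimple {n} G = (∀ i → G i i ≡ false) × (∀ i j → G i j ≡ G j i)

ind : Bool → ℕ
ind true = 1
ind false = 0

deg : ∀ {n} → Graph n → Fin n → ℕ
deg {n} G i = sum (map (λ j → ind (G i j)) (allFin n))

NoIsolated : ∀ {n} → Graph n → Set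
NoIsolated {n} G = ∀ i → 1 ≤ deg G i

numEdges : ∀ {n} → Graph n → ℕ
numEdges {n} G =
  sum (map (λ i → sum (map (λ j → ind (does (toℕ i <? toℕ j) ∧ G i j)) (allFin n))) (allFin n))

-- An edge is represented canonically as an ordered pair (i , j) with i < j.
Edge : ℕ → Set
Edge n = Fin n × Fin n

IsEdgeOf : ∀ {n} → Graph n → Edge n → Set
IsEdgeOf G (i , j) = (toℕ i < toℕ j) × (G i j ≡ true)

DisjointEdges : ∀ {n} → Edge n → Edge n → Set
DisjointEdges (a , b) (c , d) = (a ≢ c) × (a ≢ d) × (b ≢ c) × (b ≢ d)

-- A matching: a list of edges of G, pairwise disjoint (hence also duplicate-free).
IsMatching : ∀ {n} → Graph n → List (Edge n) → Set
IsMatching G M = All (IsEdgeOf G) M × AllPairs DisjointEdges M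

IsMaximalMatching : ∀ {n} → Graph n → List (Edge n) → Set
IsMaximalMatching G M =
  IsMatching G M × (∀ M′ → IsMatching G M′ → M ⊆ M′ → M′ ⊆ M)

-- σ arranges the degree sequence: σ is a bijection of Fin n (injective suffices
-- on a finite set) and d_i = deg (σ i) is non-increasing.
IsArrangement : ∀ {n} → Graph n → (Fin n → Fin n) → Set
IsArrangement {n} G σ =
  (∀ i j → σ i ≡ σ j → i ≡ j) ×
  (∀ (i j : Fin n) → toℕ i ≤ toℕ j → deg G (σ j) ≤ deg G (σ i))

topSum : ∀ {n} → Graph n → (Fin n → Fin n) → ℕ → ℕ
topSum {n} G σ r =
  sum (map (λ i → if does (toℕ i <? r) then deg G (σ i) else 0) (allFin n))

-- the condition  sum_{i ≤ 2k} d_i - m(G) - k ≥ 0  (rearranged in ℕ)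
Cond : ∀ {n} → Graph n → (Fin n → Fin n) → ℕ → Set
Cond G σ k = numEdges G + k ≤ topSum G σ (2 * k)

IsKStar : ∀ {n} → Graph n → (Fin n → Fin n) → ℕ → Set
IsKStar {n} G σ k =
  (2 * k ≤ n) × Cond G σ k × (∀ k′ → 2 * k′ ≤ n → Cond G σ k′ → k ≤ k′)

IsRealizationOf : ∀ {n} → Graph n → Graph n → Set
IsRealizationOf {n} G H = IsSimple H × (∀ i → deg H i ≡ deg G i)

-- Let M be a maximal matching and let c v ∈ {0, 1} record whether M covers v. By maximality the
-- covered vertices form a vertex cover, so c v + c w ≥ 1 for every edge vw, and c v + c w = 2 for
-- the |M| edges of M. Summing over the edges and using the handshake identity
-- Σ_{vw ∈ E} (c v + c w) = Σ_v c v · deg v gives m(G) + |M| ≤ Σ_v c v · deg v; since exactly 2|M|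
-- vertices are covered, the right-hand side is at most d_1 + ⋯ + d_{2|M|}. So k = |M| satisfies the
-- condition defining k*, whence k* ≤ |M|. Every realization H has the same degrees, hence the same
-- number of edges and the same condition, and a greedily built matching of H is maximal; k* of its
-- edges form the required matching.

module Submission where

open import Defs
open import Data.Bool using (true; false; if_then_else_; _∧_)
open import Data.Nat using (ℕ; zero; suc; _+_; _*_; _≤_; _<_; z≤n; s≤s)
open import Data.Nat.Properties
open import Data.Fin using (Fin; toℕ; zero; suc)
import Data.Fin.Properties as Finₚ
open import Data.List using (List; []; _∷_; length; map; tabulate; allFin; take; foldl; cartesianProduct)
open import Data.Nat.ListAction using () renaming (sum to listSum)
open import Data.List.Properties using (map-tabulate; map-cong; length-take)
open import Data.List.Relation.Unary.All as All using (All; []; _∷_)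
open import Data.List.Relation.Unary.AllPairs using ([]; _∷_)
open import Data.List.Relation.Unary.Any using (here; there)
import Data.List.Relation.Unary.All.Properties as Allₚ
import Data.List.Relation.Unary.AllPairs.Properties as AllPairsₚ
open import Data.List.Membership.Propositional using (_∈_)
open import Data.List.Membership.Propositional.Properties using (∈-allFin; ∈-cartesianProduct⁺)
open import Data.Product using (_×_; _,_; Σ; proj₁)
open import Data.Sum using (_⊎_; inj₁; inj₂; [_,_])
open import Data.Empty using (⊥-elim)
open import Function using (id; _∘_)
open import Function.Definitions using (Injective)
open import Relation.Binary.PropositionalEquality
  using (_≡_; _≢_; refl; sym; trans; cong; cong₂; subst; subst₂; module ≡-Reasoning)
open import Relation.Binary.Definitions using (tri<; tri≈; tri>)
open import Relation.Nullary using (¬_; does; yes; no; Dec)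
open import Relation.Nullary.Decidable using (dec-true; dec-false; _×-dec_; _⊎-dec_; ¬?; decidable-stable)
import Data.Bool.Properties as Bool
open import Algebra.Properties.Semiring.Sum +-*-semiring
  using (sum; sum-syntax; ∑-distrib-+; ∑-comm; sum-cong-≗; sum-replicate-zero; *-distribˡ-sum; *-distribʳ-sum)

sum-allFin : ∀ {n} (f : Fin n → ℕ) → listSum (map f (allFin n)) ≡ ∑[ i < n ] f i
sum-allFin f = trans (cong listSum (map-tabulate id f)) (sum-tabulate f)
  where
  sum-tabulate : ∀ {m} (g : Fin m → ℕ) → listSum (tabulate g) ≡ sum g
  sum-tabulate {zero} g = refl
  sum-tabulate {suc m} g = cong (g zero +_) (sum-tabulate (g ∘ suc))

∑-mono-≤ : ∀ {n} {f g : Fin n → ℕ} → (∀ i → f i ≤ g i) → ∑[ i < n ] f i ≤ ∑[ i < n ] g i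
∑-mono-≤ {zero} _ = z≤n
∑-mono-≤ {suc n} f≤g = +-mono-≤ (f≤g zero) (∑-mono-≤ (f≤g ∘ suc))

∑∑-distrib-+ : ∀ {m n} (f g : Fin m → Fin n → ℕ) →
               ∑[ i < m ] ∑[ j < n ] (f i j + g i j) ≡ ∑[ i < m ] ∑[ j < n ] f i j + ∑[ i < m ] ∑[ j < n ] g i j
∑∑-distrib-+ {m} {n} f g =
  trans (sum-cong-≗ λ i → ∑-distrib-+ (f i) (g i))
        (∑-distrib-+ (λ i → ∑[ j < n ] f i j) (λ i → ∑[ j < n ] g i j))

∑-zero : ∀ {n} {f : Fin n → ℕ} → (∀ i → f i ≡ 0) → ∑[ i < n ] f i ≡ 0
∑-zero {n} f≡0 = trans (sum-cong-≗ f≡0) (sum-replicate-zero n)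

∑-one : ∀ n → ∑[ i < n ] 1 ≡ n
∑-one zero = refl
∑-one (suc n) = cong suc (∑-one n)

∑-mono-≤-≡⇒≗ : ∀ {n} {f g : Fin n → ℕ} → (∀ i → f i ≤ g i) →
               ∑[ i < n ] f i ≡ ∑[ i < n ] g i → ∀ i → f i ≡ g i
∑-mono-≤-≡⇒≗ {suc n} {f} {g} f≤g ∑f≡∑g = λ where
    zero → ≤-antisym (f≤g zero)
      (+-cancelʳ-≤ G _ _ (subst (_≤ f zero + G) ∑f≡∑g (+-monoʳ-≤ (f zero) F≤G)))
    (suc i) → ∑-mono-≤-≡⇒≗ (f≤g ∘ suc) (≤-antisym F≤G
      (+-cancelˡ-≤ (g zero) _ _ (subst (_≤ g zero + F) ∑f≡∑g (+-monoˡ-≤ F (f≤g zero))))) i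
  where
  F = ∑[ i < n ] f (suc i)
  G = ∑[ i < n ] g (suc i)
  F≤G : F ≤ G
  F≤G = ∑-mono-≤ (f≤g ∘ suc)

δ : ∀ {n} → Fin n → Fin n → ℕ
δ i j = ind (does (i Finₚ.≟ j))

δ-refl : ∀ {n} (i : Fin n) → δ i i ≡ 1
δ-refl i = cong ind (dec-true (i Finₚ.≟ i) refl)

δ-≢ : ∀ {n} {i j : Fin n} → i ≢ j → δ i j ≡ 0
δ-≢ {i = i} {j} i≢j = cong ind (dec-false (i Finₚ.≟ j) i≢j)

δ≤1 : ∀ {n} (i j : Fin n) → δ i j ≤ 1
δ≤1 i j with i Finₚ.≟ j
... | yes _ = s≤s z≤n
... | no _ = z≤n

δ-sift : ∀ {n} (a : Fin n) (g : Fin n → ℕ) → ∑[ v < n ] (δ v a * g v) ≡ g a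
δ-sift {suc n} zero g = begin
  g zero + 0 + ∑[ v < n ] 0 ≡⟨ cong (g zero + 0 +_) (∑-zero {n} λ _ → refl) ⟩
  g zero + 0 + 0            ≡⟨ trans (+-identityʳ _) (+-identityʳ _) ⟩
  g zero                    ∎
  where open ≡-Reasoning
δ-sift {suc n} (suc a) g = δ-sift a (g ∘ suc)

∑-δ≡1 : ∀ {n} (a : Fin n) → ∑[ v < n ] δ v a ≡ 1
∑-δ≡1 a = trans (sum-cong-≗ (λ v → sym (*-identityʳ (δ v a)))) (δ-sift a (λ _ → 1))

fibre-≤1 : ∀ {m n} {σ : Fin m → Fin n} → Injective _≡_ _≡_ σ → ∀ v → ∑[ i < m ] δ v (σ i) ≤ 1
fibre-≤1 {zero} _ v = z≤n
fibre-≤1 {suc m} {σ = σ} σ-inj v with v Finₚ.≟ σ zero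
... | yes refl = ≤-reflexive (cong suc (∑-zero {m} λ i → δ-≢ (Finₚ.0≢1+n ∘ σ-inj)))
... | no _ = fibre-≤1 (Finₚ.suc-injective ∘ σ-inj) v

fibre-≡1 : ∀ {n} {σ : Fin n → Fin n} → Injective _≡_ _≡_ σ → ∀ v → ∑[ i < n ] δ v (σ i) ≡ 1
fibre-≡1 {n} {σ} σ-inj = ∑-mono-≤-≡⇒≗ (fibre-≤1 σ-inj) (begin
  ∑[ v < n ] ∑[ i < n ] δ v (σ i) ≡⟨ ∑-comm (λ v i → δ v (σ i)) ⟩
  ∑[ i < n ] ∑[ v < n ] δ v (σ i) ≡⟨ sum-cong-≗ (∑-δ≡1 ∘ σ) ⟩
  ∑[ i < n ] 1                   ∎)
  where open ≡-Reasoning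

∑-reindex : ∀ {n} {σ : Fin n → Fin n} → Injective _≡_ _≡_ σ →
            (f : Fin n → ℕ) → ∑[ i < n ] f (σ i) ≡ ∑[ v < n ] f v
∑-reindex {n} {σ} σ-inj f = begin
  ∑[ i < n ] f (σ i)                   ≡⟨ sum-cong-≗ (λ i → sym (δ-sift (σ i) f)) ⟩
  ∑[ i < n ] ∑[ v < n ] (δ v (σ i) * f v) ≡⟨ ∑-comm (λ i v → δ v (σ i) * f v) ⟩
  ∑[ v < n ] ∑[ i < n ] (δ v (σ i) * f v)
    ≡⟨ sum-cong-≗ (λ v → *-distribʳ-sum (f v) (λ i → δ v (σ i))) ⟨
  ∑[ v < n ] ((∑[ i < n ] δ v (σ i)) * f v)
    ≡⟨ sum-cong-≗ (λ v → trans (cong (_* f v) (fibre-≡1 σ-inj v)) (*-identityˡ (f v))) ⟩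
  ∑[ v < n ] f v                       ∎
  where open ≡-Reasoning

leadingSum : ∀ {n} → ℕ → (Fin n → ℕ) → ℕ
leadingSum {zero} r d = 0
leadingSum {suc n} zero d = 0
leadingSum {suc n} (suc r) d = d zero + leadingSum r (d ∘ suc)

NonIncreasing : ∀ {n} → (Fin n → ℕ) → Set
NonIncreasing {n} d = ∀ (i j : Fin n) → toℕ i ≤ toℕ j → d j ≤ d i

NonIncreasing-tail : ∀ {n} {d : Fin (suc n) → ℕ} → NonIncreasing d → NonIncreasing (d ∘ suc)
NonIncreasing-tail d↓ i j = d↓ (suc i) (suc j) ∘ s≤s

leadingSum-tail-≤ : ∀ {n} r {d : Fin (suc n) → ℕ} → NonIncreasing d → leadingSum r (d ∘ suc) ≤ leadingSum r d
leadingSum-tail-≤ {zero} r _ = z≤n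
leadingSum-tail-≤ {suc n} zero _ = z≤n
leadingSum-tail-≤ {suc n} (suc r) d↓ =
  +-mono-≤ (d↓ zero (suc zero) z≤n) (leadingSum-tail-≤ r (NonIncreasing-tail d↓))

∑-select≤leadingSum : ∀ {n} (a d : Fin n → ℕ) → (∀ i → a i ≤ 1) → NonIncreasing d →
                      ∑[ i < n ] (a i * d i) ≤ leadingSum (∑[ i < n ] a i) d
∑-select≤leadingSum {zero} a d _ _ = z≤n
∑-select≤leadingSum {suc n} a d a≤1 d↓ with a zero | a≤1 zero
... | 0 | _ = ≤-trans (∑-select≤leadingSum (a ∘ suc) (d ∘ suc) (a≤1 ∘ suc) (NonIncreasing-tail d↓))
                      (leadingSum-tail-≤ (∑[ i < n ] a (suc i)) d↓)
... | 1 | _ = +-mono-≤ (≤-reflexive (+-identityʳ (d zero)))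
                      (∑-select≤leadingSum (a ∘ suc) (d ∘ suc) (a≤1 ∘ suc) (NonIncreasing-tail d↓))
... | suc (suc _) | s≤s ()

∑-prefix≡leadingSum : ∀ {n} r (d : Fin n → ℕ) →
                      ∑[ i < n ] (if does (toℕ i <? r) then d i else 0) ≡ leadingSum r d
∑-prefix≡leadingSum {zero} r d = refl
∑-prefix≡leadingSum {suc n} zero d = ∑-zero {suc n} λ _ → refl
∑-prefix≡leadingSum {suc n} (suc r) d = cong (d zero +_) (∑-prefix≡leadingSum r (d ∘ suc))

topSum≡leadingSum : ∀ {n} (X : Graph n) (σ : Fin n → Fin n) r → topSum X σ r ≡ leadingSum r (deg X ∘ σ)
topSum≡leadingSum X σ r =
  trans (sum-allFin (λ i → if does (toℕ i <? r) then deg X (σ i) else 0)) (∑-prefix≡leadingSum r (deg X ∘ σ))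

ind≤1 : ∀ b → ind b ≤ 1
ind≤1 true = s≤s z≤n
ind≤1 false = z≤n

ind≡1⇒≡true : ∀ {b} → ind b ≡ 1 → b ≡ true
ind≡1⇒≡true {true} _ = refl

edgeInd : ∀ {n} → Graph n → Fin n → Fin n → ℕ
edgeInd X v w = ind (does (toℕ v <? toℕ w) ∧ X v w)

edgeInd-< : ∀ {n} (X : Graph n) {v w : Fin n} → toℕ v < toℕ w → edgeInd X v w ≡ ind (X v w)
edgeInd-< X {v} {w} v<w = cong (λ b → ind (b ∧ X v w)) (dec-true (toℕ v <? toℕ w) v<w)

edgeInd-≮ : ∀ {n} (X : Graph n) {v w : Fin n} → ¬ toℕ v < toℕ w → edgeInd X v w ≡ 0
edgeInd-≮ X {v} {w} v≮w = cong (λ b → ind (b ∧ X v w)) (dec-false (toℕ v <? toℕ w) v≮w)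

IsEdgeOf⇒edgeInd≡1 : ∀ {n} (X : Graph n) {v w : Fin n} → IsEdgeOf X (v , w) → edgeInd X v w ≡ 1
IsEdgeOf⇒edgeInd≡1 X (v<w , vw) = trans (edgeInd-< X v<w) (cong ind vw)

edgeInd≡1⇒IsEdgeOf : ∀ {n} (X : Graph n) {v w : Fin n} → edgeInd X v w ≡ 1 → IsEdgeOf X (v , w)
edgeInd≡1⇒IsEdgeOf X {v} {w} e≡1 with toℕ v <? toℕ w
... | yes v<w = v<w , ind≡1⇒≡true (trans (sym (edgeInd-< X v<w)) e≡1)
... | no v≮w with () ← trans (sym (edgeInd-≮ X v≮w)) e≡1

edgeInd-sym : ∀ {n} (X : Graph n) → IsSimple X → ∀ v w → edgeInd X v w + edgeInd X w v ≡ ind (X v w)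
edgeInd-sym X (loopless , symmetric) v w with <-cmp (toℕ v) (toℕ w)
... | tri< v<w _ w≮v = trans (cong₂ _+_ (edgeInd-< X v<w) (edgeInd-≮ X w≮v)) (+-identityʳ _)
... | tri> v≮w _ w<v = trans (cong₂ _+_ (edgeInd-≮ X v≮w) (edgeInd-< X w<v)) (cong ind (symmetric w v))
... | tri≈ v≮w v≡w w≮v rewrite Finₚ.toℕ-injective v≡w =
  trans (cong₂ _+_ (edgeInd-≮ X v≮w) (edgeInd-≮ X w≮v)) (cong ind (sym (loopless w)))

numEdges≡∑∑edgeInd : ∀ {n} (X : Graph n) → numEdges X ≡ ∑[ v < n ] ∑[ w < n ] edgeInd X v w
numEdges≡∑∑edgeInd {n} X =
  trans (sum-allFin (λ v → listSum (map (edgeInd X v) (allFin n)))) (sum-cong-≗ (sum-allFin ∘ edgeInd X))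

deg≡∑ : ∀ {n} (X : Graph n) v → deg X v ≡ ∑[ w < n ] ind (X v w)
deg≡∑ X v = sum-allFin (ind ∘ X v)

handshake : ∀ {n} (X : Graph n) → IsSimple X → (c : Fin n → ℕ) →
            ∑[ v < n ] ∑[ w < n ] (edgeInd X v w * (c v + c w)) ≡ ∑[ v < n ] (c v * deg X v)
handshake {n} X simple c = begin
  ∑[ v < n ] ∑[ w < n ] (e v w * (c v + c w))
    ≡⟨ sum-cong-≗ (λ v → sum-cong-≗ (λ w → *-distribˡ-+ (e v w) (c v) (c w))) ⟩
  ∑[ v < n ] ∑[ w < n ] (e v w * c v + e v w * c w)
    ≡⟨ ∑∑-distrib-+ (λ v w → e v w * c v) (λ v w → e v w * c w) ⟩
  ∑[ v < n ] ∑[ w < n ] (e v w * c v) + ∑[ v < n ] ∑[ w < n ] (e v w * c w)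
    ≡⟨ cong (∑[ v < n ] ∑[ w < n ] (e v w * c v) +_) (∑-comm (λ v w → e v w * c w)) ⟩
  ∑[ v < n ] ∑[ w < n ] (e v w * c v) + ∑[ v < n ] ∑[ w < n ] (e w v * c v)
    ≡⟨ ∑∑-distrib-+ (λ v w → e v w * c v) (λ v w → e w v * c v) ⟨
  ∑[ v < n ] ∑[ w < n ] (e v w * c v + e w v * c v)
    ≡⟨ sum-cong-≗ (λ v → sum-cong-≗ (λ w → trans (sym (*-distribʳ-+ (c v) (e v w) (e w v)))
                                                   (cong (_* c v) (edgeInd-sym X simple v w)))) ⟩
  ∑[ v < n ] ∑[ w < n ] (ind (X v w) * c v)
    ≡⟨ sum-cong-≗ (λ v → *-distribʳ-sum (c v) (ind ∘ X v)) ⟨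
  ∑[ v < n ] ((∑[ w < n ] ind (X v w)) * c v)
    ≡⟨ sum-cong-≗ (λ v → trans (*-comm _ (c v)) (cong (c v *_) (sym (deg≡∑ X v)))) ⟩
  ∑[ v < n ] (c v * deg X v) ∎
  where
  open ≡-Reasoning
  e = edgeInd X

twice-numEdges : ∀ {n} (X : Graph n) → IsSimple X → 2 * numEdges X ≡ ∑[ v < n ] deg X v
twice-numEdges {n} X simple = begin
  2 * numEdges X                                  ≡⟨ cong (2 *_) (numEdges≡∑∑edgeInd X) ⟩
  2 * ∑[ v < n ] ∑[ w < n ] edgeInd X v w          ≡⟨ *-distrib-∑∑ ⟩
  ∑[ v < n ] ∑[ w < n ] (edgeInd X v w * (1 + 1))  ≡⟨ handshake X simple (λ _ → 1) ⟩
  ∑[ v < n ] (1 * deg X v)                         ≡⟨ sum-cong-≗ (λ v → *-identityˡ (deg X v)) ⟩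
  ∑[ v < n ] deg X v                               ∎
  where
  open ≡-Reasoning
  *-distrib-∑∑ : 2 * ∑[ v < n ] ∑[ w < n ] edgeInd X v w ≡ ∑[ v < n ] ∑[ w < n ] (edgeInd X v w * 2)
  *-distrib-∑∑ = trans (*-distribˡ-sum 2 (λ v → ∑[ w < n ] edgeInd X v w))
    (sum-cong-≗ λ v → trans (*-distribˡ-sum 2 (edgeInd X v)) (sum-cong-≗ λ w → *-comm 2 (edgeInd X v w)))

numEdges-determined-by-degrees : ∀ {n} {G H : Graph n} → IsSimple G → IsSimple H →
                                 (∀ v → deg H v ≡ deg G v) → numEdges H ≡ numEdges G
numEdges-determined-by-degrees {n} {G} {H} simpleG simpleH degH≡degG =
  *-cancelˡ-≡ (numEdges H) (numEdges G) 2 (begin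
    2 * numEdges H       ≡⟨ twice-numEdges H simpleH ⟩
    ∑[ v < n ] deg H v   ≡⟨ sum-cong-≗ degH≡degG ⟩
    ∑[ v < n ] deg G v   ≡⟨ twice-numEdges G simpleG ⟨
    2 * numEdges G       ∎)
  where open ≡-Reasoning

incidences : ∀ {n} → Fin n → List (Edge n) → ℕ
incidences v [] = 0
incidences v ((a , b) ∷ M) = δ v a + δ v b + incidences v M

multiplicity : ∀ {n} → Fin n → Fin n → List (Edge n) → ℕ
multiplicity v w [] = 0
multiplicity v w ((a , b) ∷ M) = δ v a * δ w b + multiplicity v w M

∑-incidences : ∀ {n} (M : List (Edge n)) → ∑[ v < n ] incidences v M ≡ 2 * length M
∑-incidences {n} [] = ∑-zero {n} λ _ → refl
∑-incidences {n} ((a , b) ∷ M) = begin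
  ∑[ v < n ] (δ v a + δ v b + incidences v M)
    ≡⟨ ∑-distrib-+ (λ v → δ v a + δ v b) (λ v → incidences v M) ⟩
  ∑[ v < n ] (δ v a + δ v b) + ∑[ v < n ] incidences v M
    ≡⟨ cong₂ _+_ (trans (∑-distrib-+ (λ v → δ v a) (λ v → δ v b)) (cong₂ _+_ (∑-δ≡1 a) (∑-δ≡1 b)))
                 (∑-incidences M) ⟩
  2 + 2 * length M
    ≡⟨ *-distribˡ-+ 2 1 (length M) ⟨
  2 * suc (length M) ∎
  where open ≡-Reasoning

∑∑-multiplicity : ∀ {n} (M : List (Edge n)) → ∑[ v < n ] ∑[ w < n ] multiplicity v w M ≡ length M
∑∑-multiplicity {n} [] = ∑-zero {n} λ _ → ∑-zero {n} λ _ → refl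
∑∑-multiplicity {n} ((a , b) ∷ M) = begin
  ∑[ v < n ] ∑[ w < n ] (δ v a * δ w b + multiplicity v w M)
    ≡⟨ ∑∑-distrib-+ (λ v w → δ v a * δ w b) (λ v w → multiplicity v w M) ⟩
  ∑[ v < n ] ∑[ w < n ] (δ v a * δ w b) + ∑[ v < n ] ∑[ w < n ] multiplicity v w M
    ≡⟨ cong₂ _+_ (trans (sum-cong-≗ δ-sift-row) (∑-δ≡1 a)) (∑∑-multiplicity M) ⟩
  suc (length M) ∎
  where
  open ≡-Reasoning
  δ-sift-row : ∀ v → ∑[ w < n ] (δ v a * δ w b) ≡ δ v a
  δ-sift-row v = trans (sym (*-distribˡ-sum (δ v a) (λ w → δ w b)))
                       (trans (cong (δ v a *_) (∑-δ≡1 b)) (*-identityʳ (δ v a)))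

Avoids : ∀ {n} → Fin n → Edge n → Set
Avoids v (a , b) = v ≢ a × v ≢ b

incidences≡0⇒avoids : ∀ {n} {v : Fin n} (M : List (Edge n)) → incidences v M ≡ 0 → All (Avoids v) M
incidences≡0⇒avoids [] _ = []
incidences≡0⇒avoids {v = v} ((a , b) ∷ M) eq with v Finₚ.≟ a | v Finₚ.≟ b
... | yes _ | _ with () ← eq
... | no _ | yes _ with () ← eq
... | no v≢a | no v≢b = (v≢a , v≢b) ∷ incidences≡0⇒avoids M eq

avoids⇒incidences≡0 : ∀ {n} {v : Fin n} (M : List (Edge n)) → All (Avoids v) M → incidences v M ≡ 0
avoids⇒incidences≡0 [] [] = refl
avoids⇒incidences≡0 (_ ∷ M) ((v≢a , v≢b) ∷ rest) =
  cong₂ _+_ (cong₂ _+_ (δ-≢ v≢a) (δ-≢ v≢b)) (avoids⇒incidences≡0 M rest)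

disjoint⇒avoidsˡ : ∀ {n} {a b : Fin n} {M : List (Edge n)} → All (DisjointEdges (a , b)) M → All (Avoids a) M
disjoint⇒avoidsˡ = All.map (λ (a≢c , a≢d , _ , _) → a≢c , a≢d)

disjoint⇒avoidsʳ : ∀ {n} {a b : Fin n} {M : List (Edge n)} → All (DisjointEdges (a , b)) M → All (Avoids b) M
disjoint⇒avoidsʳ = All.map (λ (_ , _ , b≢c , b≢d) → b≢c , b≢d)

matching⇒incidences≤1 : ∀ {n} {X : Graph n} (M : List (Edge n)) → IsMatching X M → ∀ v → incidences v M ≤ 1
matching⇒incidences≤1 [] _ v = z≤n
matching⇒incidences≤1 ((a , b) ∷ M) ((ab ∷ edges) , (ab-disj ∷ disjoint)) v with v Finₚ.≟ a | v Finₚ.≟ b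
... | yes refl | yes refl = ⊥-elim (<-irrefl refl (proj₁ ab))
... | yes refl | no _ = ≤-reflexive (cong suc (avoids⇒incidences≡0 M (disjoint⇒avoidsˡ ab-disj)))
... | no _ | yes refl = ≤-reflexive (cong suc (avoids⇒incidences≡0 M (disjoint⇒avoidsʳ ab-disj)))
... | no _ | no _ = matching⇒incidences≤1 M (edges , disjoint) v

multiplicity≤incidencesˡ : ∀ {n} (v w : Fin n) M → multiplicity v w M ≤ incidences v M
multiplicity≤incidencesˡ v w [] = z≤n
multiplicity≤incidencesˡ v w ((a , b) ∷ M) = +-mono-≤ (begin
  δ v a * δ w b  ≤⟨ *-monoʳ-≤ (δ v a) (δ≤1 w b) ⟩
  δ v a * 1      ≡⟨ *-identityʳ (δ v a) ⟩
  δ v a          ≤⟨ m≤m+n (δ v a) (δ v b) ⟩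
  δ v a + δ v b  ∎) (multiplicity≤incidencesˡ v w M)
  where open ≤-Reasoning

multiplicity≤incidencesʳ : ∀ {n} (v w : Fin n) M → multiplicity v w M ≤ incidences w M
multiplicity≤incidencesʳ v w [] = z≤n
multiplicity≤incidencesʳ v w ((a , b) ∷ M) = +-mono-≤ (begin
  δ v a * δ w b  ≤⟨ *-monoˡ-≤ (δ w b) (δ≤1 v a) ⟩
  1 * δ w b      ≡⟨ *-identityˡ (δ w b) ⟩
  δ w b          ≤⟨ m≤n+m (δ w b) (δ w a) ⟩
  δ w a + δ w b  ∎) (multiplicity≤incidencesʳ v w M)
  where open ≤-Reasoning

multiplicity>0⇒IsEdgeOf : ∀ {n} (X : Graph n) {v w : Fin n} M → All (IsEdgeOf X) M →
                          1 ≤ multiplicity v w M → IsEdgeOf X (v , w)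
multiplicity>0⇒IsEdgeOf X {v} {w} ((a , b) ∷ M) (ab ∷ edges) m>0 with v Finₚ.≟ a | w Finₚ.≟ b
... | yes refl | yes refl = ab
... | yes _ | no _ = multiplicity>0⇒IsEdgeOf X M edges m>0
... | no _ | yes _ = multiplicity>0⇒IsEdgeOf X M edges m>0
... | no _ | no _ = multiplicity>0⇒IsEdgeOf X M edges m>0

CoveredBy : ∀ {n} → List (Edge n) → Edge n → Set
CoveredBy M (v , w) = 1 ≤ incidences v M ⊎ 1 ≤ incidences w M

Covers : ∀ {n} → Graph n → List (Edge n) → Set
Covers X M = ∀ e → IsEdgeOf X e → CoveredBy M e

-- For a pair vw: e and m count vw as an edge of X and of M, x and y count how often M covers v and w.
e+m≤e*[x+y] : ∀ {e m x y} → e ≤ 1 → x ≤ 1 → y ≤ 1 → m ≤ x → m ≤ y →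
             (1 ≤ m → e ≡ 1) → (e ≡ 1 → 1 ≤ x ⊎ 1 ≤ y) → e + m ≤ e * (x + y)
e+m≤e*[x+y] {0} {0} _ _ _ _ _ _ _ = z≤n
e+m≤e*[x+y] {0} {suc _} _ _ _ _ _ m>0⇒e≡1 _ with () ← m>0⇒e≡1 (s≤s z≤n)
e+m≤e*[x+y] {1} {0} {x} {y} _ _ _ _ _ _ e≡1⇒covered = subst (1 ≤_) (sym (*-identityˡ (x + y)))
  ([ (λ 1≤x → ≤-trans 1≤x (m≤m+n x y)) , (λ 1≤y → ≤-trans 1≤y (m≤n+m y x)) ] (e≡1⇒covered refl))
e+m≤e*[x+y] {1} {1} {1} {1} _ _ _ _ _ _ _ = ≤-refl
e+m≤e*[x+y] {suc (suc _)} (s≤s ()) _ _ _ _ _ _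
e+m≤e*[x+y] {m = suc (suc _)} {1} _ _ _ (s≤s ()) _ _ _
e+m≤e*[x+y] {x = suc (suc _)} _ (s≤s ()) _ _ _ _ _
e+m≤e*[x+y] {y = suc (suc _)} _ _ (s≤s ()) _ _ _ _

module _ {n} {X : Graph n} {M : List (Edge n)} (matching : IsMatching X M) where

  2*length≤n : 2 * length M ≤ n
  2*length≤n = begin
    2 * length M                ≡⟨ ∑-incidences M ⟨
    ∑[ v < n ] incidences v M   ≤⟨ ∑-mono-≤ (matching⇒incidences≤1 M matching) ⟩
    ∑[ v < n ] 1                ≡⟨ ∑-one n ⟩
    n                           ∎
    where open ≤-Reasoning

  edgeInd+multiplicity≤ : Covers X M → ∀ v w →
    edgeInd X v w + multiplicity v w M ≤ edgeInd X v w * (incidences v M + incidences w M)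
  edgeInd+multiplicity≤ covers v w =
    e+m≤e*[x+y] (ind≤1 _) (matching⇒incidences≤1 M matching v) (matching⇒incidences≤1 M matching w)
               (multiplicity≤incidencesˡ v w M) (multiplicity≤incidencesʳ v w M)
               (IsEdgeOf⇒edgeInd≡1 X ∘ multiplicity>0⇒IsEdgeOf X M (proj₁ matching))
               (covers (v , w) ∘ edgeInd≡1⇒IsEdgeOf X)

  numEdges+size≤∑incidences*deg : IsSimple X → Covers X M →
    numEdges X + length M ≤ ∑[ v < n ] (incidences v M * deg X v)
  numEdges+size≤∑incidences*deg simple covers = begin
    numEdges X + length M
      ≡⟨ cong₂ _+_ (numEdges≡∑∑edgeInd X) (sym (∑∑-multiplicity M)) ⟩
    ∑[ v < n ] ∑[ w < n ] edgeInd X v w + ∑[ v < n ] ∑[ w < n ] multiplicity v w M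
      ≡⟨ ∑∑-distrib-+ (edgeInd X) (λ v w → multiplicity v w M) ⟨
    ∑[ v < n ] ∑[ w < n ] (edgeInd X v w + multiplicity v w M)
      ≤⟨ ∑-mono-≤ (λ v → ∑-mono-≤ (edgeInd+multiplicity≤ covers v)) ⟩
    ∑[ v < n ] ∑[ w < n ] (edgeInd X v w * (incidences v M + incidences w M))
      ≡⟨ handshake X simple (λ v → incidences v M) ⟩
    ∑[ v < n ] (incidences v M * deg X v) ∎
    where open ≤-Reasoning

∑weight*deg≤topSum : ∀ {n} {X : Graph n} {σ : Fin n → Fin n} → IsArrangement X σ →
                     (c : Fin n → ℕ) → (∀ v → c v ≤ 1) →
                     ∑[ v < n ] (c v * deg X v) ≤ topSum X σ (∑[ v < n ] c v)
∑weight*deg≤topSum {n} {X} {σ} (σ-injective , σ-sorts) c c≤1 = begin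
  ∑[ v < n ] (c v * deg X v)           ≡⟨ ∑-reindex inj (λ v → c v * deg X v) ⟨
  ∑[ i < n ] (c (σ i) * deg X (σ i))   ≤⟨ ∑-select≤leadingSum (c ∘ σ) (deg X ∘ σ) (c≤1 ∘ σ) σ-sorts ⟩
  leadingSum (∑[ i < n ] c (σ i)) (deg X ∘ σ) ≡⟨ cong (λ r → leadingSum r (deg X ∘ σ)) (∑-reindex inj c) ⟩
  leadingSum (∑[ v < n ] c v) (deg X ∘ σ)     ≡⟨ topSum≡leadingSum X σ (∑[ v < n ] c v) ⟨
  topSum X σ (∑[ v < n ] c v)          ∎
  where
  open ≤-Reasoning
  inj : Injective _≡_ _≡_ σ
  inj {i} {j} = σ-injective i j

covering-matching⇒Cond : ∀ {n} {X : Graph n} {σ : Fin n → Fin n} {M : List (Edge n)} →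
                         IsSimple X → IsArrangement X σ → IsMatching X M → Covers X M → Cond X σ (length M)
covering-matching⇒Cond {n} {X} {σ} {M} simple arrangement matching covers = begin
  numEdges X + length M
    ≤⟨ numEdges+size≤∑incidences*deg matching simple covers ⟩
  ∑[ v < n ] (incidences v M * deg X v)
    ≤⟨ ∑weight*deg≤topSum arrangement (λ v → incidences v M) (matching⇒incidences≤1 M matching) ⟩
  topSum X σ (∑[ v < n ] incidences v M)
    ≡⟨ cong (topSum X σ) (∑-incidences M) ⟩
  topSum X σ (2 * length M) ∎
  where open ≤-Reasoning

CoveredBy? : ∀ {n} (M : List (Edge n)) e → Dec (CoveredBy M e)
CoveredBy? M (v , w) = (1 ≤? incidences v M) ⊎-dec (1 ≤? incidences w M)

CoveredBy-mono : ∀ {n} {M M′ : List (Edge n)} → (∀ u → incidences u M ≤ incidences u M′) →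
                 ∀ {e} → CoveredBy M e → CoveredBy M′ e
CoveredBy-mono M≤M′ {v , _} (inj₁ v-covered) = inj₁ (≤-trans v-covered (M≤M′ v))
CoveredBy-mono M≤M′ {_ , w} (inj₂ w-covered) = inj₂ (≤-trans w-covered (M≤M′ w))

∈⇒CoveredBy : ∀ {n} {M : List (Edge n)} {e} → e ∈ M → CoveredBy M e
∈⇒CoveredBy {M = (v , w) ∷ M} (here refl) = inj₁ (begin
  1                                ≡⟨ δ-refl v ⟨
  δ v v                            ≤⟨ m≤m+n (δ v v) (δ v w) ⟩
  δ v v + δ v w                    ≤⟨ m≤m+n (δ v v + δ v w) (incidences v M) ⟩
  δ v v + δ v w + incidences v M   ∎)
  where open ≤-Reasoning
∈⇒CoveredBy {M = (a , b) ∷ M} {e} (there e∈M) =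
  CoveredBy-mono {M = M} {(a , b) ∷ M} (λ u → m≤n+m (incidences u M) (δ u a + δ u b)) {e} (∈⇒CoveredBy {M = M} e∈M)

matching-∷ : ∀ {n} {X : Graph n} {M : List (Edge n)} {e} →
             IsMatching X M → IsEdgeOf X e → ¬ CoveredBy M e → IsMatching X (e ∷ M)
matching-∷ {M = M} {v , w} (edges , disjoint) vw uncovered =
  (vw ∷ edges) , (All.zipWith (λ ((v≢a , v≢b) , (w≢a , w≢b)) → v≢a , v≢b , w≢a , w≢b)
                              (incidences≡0⇒avoids M (free (uncovered ∘ inj₁)) ,
                               incidences≡0⇒avoids M (free (uncovered ∘ inj₂)))
                 ∷ disjoint)
  where
  free : ∀ {u} → ¬ 1 ≤ incidences u M → incidences u M ≡ 0
  free = n<1⇒n≡0 ∘ ≰⇒>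

maximal⇒Covers : ∀ {n} {X : Graph n} {M : List (Edge n)} → IsMaximalMatching X M → Covers X M
maximal⇒Covers {M = M} (matching , maximal) e edge with CoveredBy? M e
... | yes covered = covered
... | no uncovered =
  ⊥-elim (uncovered (∈⇒CoveredBy (maximal (e ∷ M) (matching-∷ matching edge uncovered) there (here refl))))

module Greedy {n} (X : Graph n) where

  Addable : List (Edge n) → Edge n → Set
  Addable M e = IsEdgeOf X e × ¬ CoveredBy M e

  addable? : ∀ M e → Dec (Addable M e)
  addable? M (v , w) = ((toℕ v <? toℕ w) ×-dec (X v w Bool.≟ true)) ×-dec ¬? (CoveredBy? M (v , w))

  extend : List (Edge n) → Edge n → List (Edge n)
  extend M e with addable? M e
  ... | yes _ = e ∷ M
  ... | no _ = M

  extend-matching : ∀ {M} e → IsMatching X M → IsMatching X (extend M e)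
  extend-matching {M} e matching with addable? M e
  ... | yes (edge , uncovered) = matching-∷ matching edge uncovered
  ... | no _ = matching

  extend-incidences : ∀ M e u → incidences u M ≤ incidences u (extend M e)
  extend-incidences M (a , b) u with addable? M (a , b)
  ... | yes _ = m≤n+m (incidences u M) (δ u a + δ u b)
  ... | no _ = ≤-refl

  extend-covers : ∀ M e → IsEdgeOf X e → CoveredBy (extend M e) e
  extend-covers M e edge with addable? M e
  ... | yes _ = ∈⇒CoveredBy {M = e ∷ M} (here refl)
  ... | no not-addable = decidable-stable (CoveredBy? M e) (λ uncovered → not-addable (edge , uncovered))

  greedy : List (Edge n) → List (Edge n) → List (Edge n)
  greedy = foldl extend

  greedy-matching : ∀ {M} es → IsMatching X M → IsMatching X (greedy M es)
  greedy-matching [] matching = matching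
  greedy-matching (e ∷ es) matching = greedy-matching es (extend-matching e matching)

  greedy-incidences : ∀ M es u → incidences u M ≤ incidences u (greedy M es)
  greedy-incidences M [] u = ≤-refl
  greedy-incidences M (e ∷ es) u = ≤-trans (extend-incidences M e u) (greedy-incidences (extend M e) es u)

  greedy-covers : ∀ M {es e} → e ∈ es → IsEdgeOf X e → CoveredBy (greedy M es) e
  greedy-covers M {e ∷ es} (here refl) edge =
    CoveredBy-mono {M = extend M e} {greedy (extend M e) es} (greedy-incidences (extend M e) es) {e} (extend-covers M e edge)
  greedy-covers M {e′ ∷ es} (there e∈es) edge = greedy-covers (extend M e′) e∈es edge

  covering-matching : Σ (List (Edge n)) λ M → IsMatching X M × Covers X M
  covering-matching =
    greedy [] candidates , greedy-matching candidates ([] , []) ,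
    λ (v , w) edge → greedy-covers [] (∈-cartesianProduct⁺ (∈-allFin v) (∈-allFin w)) edge
    where candidates = cartesianProduct (allFin n) (allFin n)

module _ {n} {G H : Graph n} (simpleG : IsSimple G) (simpleH : IsSimple H)
         (degH≡degG : ∀ v → deg H v ≡ deg G v) (σ : Fin n → Fin n) where

  IsArrangement-transfer : IsArrangement G σ → IsArrangement H σ
  IsArrangement-transfer (σ-injective , σ-sorts) =
    σ-injective , λ i j i≤j → subst₂ _≤_ (sym (degH≡degG (σ j))) (sym (degH≡degG (σ i))) (σ-sorts i j i≤j)

  Cond-transfer : ∀ {k} → Cond H σ k → Cond G σ k
  Cond-transfer {k} = subst₂ _≤_ (cong (_+ k) (numEdges-determined-by-degrees simpleG simpleH degH≡degG)) topSum-transfer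
    where
    topSum-transfer : topSum H σ (2 * k) ≡ topSum G σ (2 * k)
    topSum-transfer = cong listSum (map-cong (λ i → cong (λ d → if does (toℕ i <? 2 * k) then d else 0)
                                                         (degH≡degG (σ i))) (allFin n))

take-matching : ∀ {n} {X : Graph n} {M} k → IsMatching X M → IsMatching X (take k M)
take-matching k (edges , disjoint) = Allₚ.take⁺ k edges , AllPairsₚ.take⁺ k disjoint

theorem4p4 : ∀ (n : ℕ) (G : Graph n) (σ : Fin n → Fin n) (kstar : ℕ) →
    IsSimple G → NoIsolated G → IsArrangement G σ → IsKStar G σ kstar →
    (∀ (M : List (Edge n)) → IsMaximalMatching G M → kstar ≤ length M)
    × (∀ (H : Graph n) → IsRealizationOf G H →
         Σ (List (Edge n)) (λ M → IsMatching H M × length M ≡ kstar))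
theorem4p4 n G σ kstar simple _ arrangement (_ , _ , minimal) = maximal-bound , realization-matching
  where
  maximal-bound : ∀ M → IsMaximalMatching G M → kstar ≤ length M
  maximal-bound M maximal@(matching , _) =
    minimal (length M) (2*length≤n matching) (covering-matching⇒Cond simple arrangement matching (maximal⇒Covers maximal))

  realization-matching : ∀ H → IsRealizationOf G H → Σ (List (Edge n)) (λ M → IsMatching H M × length M ≡ kstar)
  realization-matching H (simpleH , degH≡degG) with Greedy.covering-matching H
  ... | M , matching , covers =
    take kstar M , take-matching kstar matching , trans (length-take kstar M) (m≤n⇒m⊓n≡m kstar≤|M|)
    where
    kstar≤|M| : kstar ≤ length M
    kstar≤|M| = minimal (length M) (2*length≤n matching)
      (Cond-transfer simple simpleH degH≡degG σ
        (covering-matching⇒Cond simpleH (IsArrangement-transfer simple simpleH degH≡degG σ arrangement) matching covers))
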